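{- Let $x\in F_P$ and $\lambda\in F_D$ with $f_P(x)=f_D(\lambda)$. Then $x$ solves $(PP_{opt})$ with primal optimal value $v_P=0$, and $\lambda$ solves $(DP_{opt})$ with dual optimal value $v_D=0$.
   Context: Let $n\ge 2$ be an integer and $s(m)=\sum_{i=1}^{m-1} i$. Define matrices $A(m)$ with $s(m)$ rows and $m$ columns recursively: $A(1)$ is the empty matrix, and for $m\ge 2$, $A(m)=\begin{pmatrix}\mathbf{1}_{m-1} & -U_{m-1}\\ \mathbf{0}_{s(m-1)} & A(m-1)\end{pmatrix}$, where $\mathbf{1}_{m-1}$ is the column vector of ones, $U_{m-1}$ is the identity matrix and $\mathbf{0}_{s(m-1)}$ the zero column of length $s(m-1)$. Let $A$ be the $n\,s(n)\times n^2$ block-diagonal matrix with $n$ copies of $A(n)$ on its diagonal. For a permutation $\pi$ of $\{1,\dots,n^2\}$ let $A_\pi=(a^{\pi^{ -1}(1)},\dots,a^{\pi^{ -1}(n^2)})$, $a^j$ the $j$-th column of $A$. Fix permutations $\pi_1,\pi_2,\pi_3$ of $\{1,\dots,n^2\}$, $0\le k\le n^2$, an index set $\{i_1,\dots,i_k\}\subset\{1,\dots,n^2\}$, integers $g_{i_l}\in[1,n]$, $g=(g_{i_1},\dots,g_{i_k})^T$, and $A_{eq}$ the $k\times n^2$ matrix with $[A_{eq}x]_l=x_{i_l}$. Let $\mathbb{Z}_\infty=\mathbb{Z}\cup\{\infty\}$, where $\infty$ is a formal token with $\infty+x=x+\infty=\infty+\infty=\infty$ for $x\in\mathbb{Z}$,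 $0\cdot\infty=\infty\cdot 0=0$, $x\cdot\infty=\infty\cdot x=\infty$ for $x\in\mathbb Z\setminus\{0\}$, and $\infty\ne x$ for every $x\in\mathbb{Z}$ (in particular $\infty\neq0$); matrix–vector products are extended using these rules. For a vector $y$, $y<>\mathbf{0}$ means every component of $y$ is different from $0$. $F_P=\{x\in\mathbb{Z}_\infty^{n^2}\mid$ for each $i$, $1\le x_i\le n$ or $x_i=\infty$; $A_{\pi_r}x<>\mathbf{0}$ for $r=1,2,3$; $A_{eq}x=g\}$, $f_P(x)=\sharp\{i\mid x_i=\infty\}$; $(PP_{opt})$: minimize $f_P$ over $F_P$, with optimal value $v_P=\min\{f_P(x)\mid x\in F_P\}$; $x$ solves $(PP_{opt})$ if $x\in F_P$ and $f_P(x)=v_P$. $F_D=\{\lambda\in\{ -1,+1\}^{n\cdot s(n)}\mid A_{\pi_r}A_{\pi_1}^T\lambda<>\mathbf{0}\text{ for }r=1,2,3\}$, $f_D(\lambda)=\sharp\{1\le l\le k\mid [A_{eq}A_{\pi_1}^T\lambda]_l=2g_{i_l}-(n+1)\}-k$; $(DP_{opt})$: maximize $f_D$ over $F_D$, with optimal value $v_D=\max\{f_D(\lambda)\mid \lambda\in F_D\}$; $\lambda$ solves $(DP_{opt})$ if $\lambda\in F_D$ and $f_D(\lambda)=v_D$. -}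

module Defs where

open import Data.Nat as ℕ using (ℕ; zero; suc)
open import Data.Integer as ℤ using (ℤ; +_; -_; 1ℤ; -1ℤ; 0ℤ)
open import Data.Fin as Fin using (Fin; zero; suc; splitAt; remQuot)
open import Data.Fin.Permutation using (Permutation′; _⟨$⟩ˡ_)
open import Data.Sum using (_⊎_; inj₁; inj₂)
open import Data.Product using (_×_; _,_; ∃)
open import Data.Bool using (Bool; true; false; if_then_else_)
open import Relation.Nullary using (¬_; does)
open import Relation.Binary.PropositionalEquality using (_≡_; _≢_)
open import Function.Definitions using (Injective)

-- s(m) = Σ_{i=1}^{m-1} i, via s(m+1) = m + s(m)
s : ℕ → ℕ
s zero    = 0
s (suc m) = m ℕ.+ s m

Mat : ℕ → ℕ → Set
Mat r c = Fin r → Fin c → ℤ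

transpose : ∀ {r c} → Mat r c → Mat c r
transpose M i j = M j i

-- A(m): s(m) × m matrix, defined recursively.
-- A(m+1) = [ 1_m  | -U_m ; 0_{s(m)} | A(m) ]
Am : (m : ℕ) → Mat (s m) m
Am zero    ()
Am (suc m) r c with splitAt m r
Am (suc m) r zero    | inj₁ i = 1ℤ
Am (suc m) r (suc j) | inj₁ i = if does (i Fin.≟ j) then -1ℤ else 0ℤ
Am (suc m) r zero    | inj₂ r' = 0ℤ
Am (suc m) r (suc j) | inj₂ r' = Am m r' j

-- A: block-diagonal with n copies of A(n); rows/columns ordered block by block
Ablk : (n : ℕ) → Mat (n ℕ.* s n) (n ℕ.* n)
Ablk n r c with remQuot {n} (s n) r | remQuot {n} n c
... | b₁ , i | b₂ , j = if does (b₁ Fin.≟ b₂) then Am n i j else 0ℤ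

-- A_π: column j of A_π is column π⁻¹(j) of A
Aperm : (n : ℕ) → Permutation′ (n ℕ.* n) → Mat (n ℕ.* s n) (n ℕ.* n)
Aperm n π r j = Ablk n r (π ⟨$⟩ˡ j)

Aeq : ∀ {k N} → (Fin k → Fin N) → Mat k N
Aeq idx l j = if does (idx l Fin.≟ j) then 1ℤ else 0ℤ

data ℤ∞ : Set where
  fin : ℤ → ℤ∞
  ∞   : ℤ∞

_+∞_ : ℤ∞ → ℤ∞ → ℤ∞
fin a +∞ fin b = fin (a ℤ.+ b)
fin a +∞ ∞     = ∞
∞     +∞ _     = ∞

-- integer times ℤ_∞ (0·∞ = 0, x·∞ = ∞ for x ≠ 0)
_*∞_ : ℤ → ℤ∞ → ℤ∞
a *∞ fin b = fin (a ℤ.* b)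
a *∞ ∞     = if does (a ℤ.≟ 0ℤ) then fin 0ℤ else ∞

sumℤ : ∀ {m} → (Fin m → ℤ) → ℤ
sumℤ {zero}  f = 0ℤ
sumℤ {suc m} f = f zero ℤ.+ sumℤ (λ i → f (suc i))

sumℤ∞ : ∀ {m} → (Fin m → ℤ∞) → ℤ∞
sumℤ∞ {zero}  f = fin 0ℤ
sumℤ∞ {suc m} f = f zero +∞ sumℤ∞ (λ i → f (suc i))

mulV : ∀ {r c} → Mat r c → (Fin c → ℤ) → (Fin r → ℤ)
mulV M v i = sumℤ (λ j → M i j ℤ.* v j)

mulV∞ : ∀ {r c} → Mat r c → (Fin c → ℤ∞) → (Fin r → ℤ∞)
mulV∞ M v i = sumℤ∞ (λ j → M i j *∞ v j)

NonZeroVec∞ : ∀ {r} → (Fin r → ℤ∞) → Set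
NonZeroVec∞ y = ∀ i → y i ≢ fin 0ℤ

NonZeroVec : ∀ {r} → (Fin r → ℤ) → Set
NonZeroVec y = ∀ i → y i ≢ 0ℤ

count : ∀ {m} → (Fin m → Bool) → ℕ
count {zero}  p = 0
count {suc m} p = (if p zero then 1 else 0) ℕ.+ count (λ i → p (suc i))

isInf : ℤ∞ → Bool
isInf (fin _) = false
isInf ∞       = true

record Data (n : ℕ) : Set where
  field
    π₁ π₂ π₃ : Permutation′ (n ℕ.* n)
    k        : ℕ
    idx      : Fin k → Fin (n ℕ.* n)
    idx-inj  : Injective _≡_ _≡_ idx
    g        : Fin k → ℕ
    g-range  : ∀ l → 1 ℕ.≤ g l × g l ℕ.≤ n

module _ {n : ℕ} (D : Data n) where
  open Data D

  FP : (Fin (n ℕ.* n) → ℤ∞) → Set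
  FP x = (∀ i → (∃ λ z → x i ≡ fin z × + 1 ℤ.≤ z × z ℤ.≤ + n) ⊎ x i ≡ ∞)
       × NonZeroVec∞ (mulV∞ (Aperm n π₁) x)
       × NonZeroVec∞ (mulV∞ (Aperm n π₂) x)
       × NonZeroVec∞ (mulV∞ (Aperm n π₃) x)
       × (∀ l → mulV∞ (Aeq idx) x l ≡ fin (+ g l))

  fP : (Fin (n ℕ.* n) → ℤ∞) → ℕ
  fP x = count (λ i → isInf (x i))

  IsOptValP : ℕ → Set
  IsOptValP v = (∃ λ y → FP y × fP y ≡ v) × (∀ y → FP y → v ℕ.≤ fP y)

  SolvesP : (Fin (n ℕ.* n) → ℤ∞) → Set
  SolvesP x = FP x × (∀ v → IsOptValP v → fP x ≡ v)

  FD : (Fin (n ℕ.* s n) → ℤ) → Set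
  FD λ' = (∀ r → λ' r ≡ 1ℤ ⊎ λ' r ≡ -1ℤ)
        × NonZeroVec (mulV (Aperm n π₁) (mulV (transpose (Aperm n π₁)) λ'))
        × NonZeroVec (mulV (Aperm n π₂) (mulV (transpose (Aperm n π₁)) λ'))
        × NonZeroVec (mulV (Aperm n π₃) (mulV (transpose (Aperm n π₁)) λ'))

  fD : (Fin (n ℕ.* s n) → ℤ) → ℤ
  fD λ' = + count (λ l → does (mulV (Aeq idx) (mulV (transpose (Aperm n π₁)) λ') l
                                 ℤ.≟ (+ (2 ℕ.* g l) ℤ.- + (n ℕ.+ 1))))
          ℤ.- + k

  IsOptValD : ℤ → Set
  IsOptValD v = (∃ λ μ → FD μ × fD μ ≡ v) × (∀ μ → FD μ → fD μ ℤ.≤ v)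

  SolvesD : (Fin (n ℕ.* s n) → ℤ) → Set
  SolvesD λ' = FD λ' × (∀ v → IsOptValD v → fD λ' ≡ v)

-- Weak duality in its crudest form: f_P counts infinite entries, so f_P ≥ 0,
-- while f_D counts at most k hits and subtracts k, so f_D ≤ 0. Hence
-- f_P(x) = f_D(λ) forces f_P(x) = 0 = f_D(λ); a feasible point attaining a
-- global bound of its objective is optimal, and the bound is the optimal value.
module Submission where

open import Defs
open import Data.Nat using (ℕ; _≤_; z≤n; s≤s)
open import Data.Nat.Properties using (m≤n⇒m≤1+n; n≤0⇒n≡0)
open import Data.Integer using (ℤ; +_; +≤+)
open import Data.Integer.Properties using (i≤j⇒i-j≤0; drop‿+≤+; ≤-antisym)
open import Data.Fin using (Fin; zero; suc)
open import Data.Nat as ℕ using ()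
open import Data.Integer as ℤ using ()
open import Data.Bool using (Bool; true; false)
open import Data.Product using (_×_; _,_)
open import Relation.Binary.PropositionalEquality using (_≡_; sym; trans; subst; cong)

count≤ : ∀ {m} (p : Fin m → Bool) → count p ≤ m
count≤ {ℕ.zero}  p = z≤n
count≤ {ℕ.suc m} p with p zero
... | true  = s≤s (count≤ (λ i → p (suc i)))
... | false = m≤n⇒m≤1+n (count≤ (λ i → p (suc i)))

module _ {n : ℕ} (D : Data n) where

  fD≤0 : ∀ μ → fD D μ ℤ.≤ + 0
  fD≤0 μ = i≤j⇒i-j≤0 (+≤+ (count≤ {Data.k D} _))

  solvesP∧optValP-zero : ∀ x → FP D x → fP D x ≡ 0 → SolvesP D x × IsOptValP D 0
  solvesP∧optValP-zero x Fx fx≡0 = (Fx , solves) , optVal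
    where
    optVal : IsOptValP D 0
    optVal = (x , Fx , fx≡0) , λ _ _ → z≤n

    solves : ∀ v → IsOptValP D v → fP D x ≡ v
    solves v (_ , lowerBound) =
      trans fx≡0 (sym (n≤0⇒n≡0 (subst (v ≤_) fx≡0 (lowerBound x Fx))))

  solvesD∧optValD-zero : ∀ λ' → FD D λ' → fD D λ' ≡ + 0 → SolvesD D λ' × IsOptValD D (+ 0)
  solvesD∧optValD-zero λ' Fλ fλ≡0 = (Fλ , solves) , optVal
    where
    optVal : IsOptValD D (+ 0)
    optVal = (λ' , Fλ , fλ≡0) , λ μ _ → fD≤0 μ

    solves : ∀ v → IsOptValD D v → fD D λ' ≡ v
    solves v ((μ , Fμ , fμ≡v) , upperBound) =
      ≤-antisym (upperBound λ' Fλ)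
                (subst (v ℤ.≤_) (sym fλ≡0) (subst (ℤ._≤ + 0) fμ≡v (fD≤0 μ)))

theorem5p2 : (n : ℕ) → 2 ≤ n → (D : Data n)
    → (x : Fin (n ℕ.* n) → ℤ∞) → (λ' : Fin (n ℕ.* s n) → ℤ)
    → FP D x → FD D λ' → + fP D x ≡ fD D λ'
    → (SolvesP D x × IsOptValP D 0) × (SolvesD D λ' × IsOptValD D (+ 0))
theorem5p2 n _ D x λ' Fx Fλ fx≡fλ =
  solvesP∧optValP-zero D x Fx fx≡0 , solvesD∧optValD-zero D λ' Fλ fλ≡0
  where
  fx≡0 : fP D x ≡ 0
  fx≡0 = n≤0⇒n≡0 (drop‿+≤+ (subst (ℤ._≤ + 0) (sym fx≡fλ) (fD≤0 D λ')))

  fλ≡0 : fD D λ' ≡ + 0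
  fλ≡0 = trans (sym fx≡fλ) (cong +_ fx≡0)
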